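{- Let $n \ge 1$ be an integer. The DDG corresponding to the algorithm $\textsf{optimal\_uniform}(n)$ is an optimal DDG for the uniform distribution on $\{1, \ldots, n\}$. Here $\textsf{optimal\_uniform}(n)$ is: (1) set $m \leftarrow 1$, $X \leftarrow 1$; (2) while $m < n$: (3) flip a fair coin $B \in \{0,1\}$; (4) set $X \leftarrow X + Bm$, $m \leftarrow 2m$; (5) if $m \ge n$ and $X \le n$ then $m \leftarrow n$; (6) if $m \ge n$ and $X > n$ then $X \leftarrow X - n$, $m \leftarrow m - n$; (7) return $X$.
   Context: A discrete distribution generating tree (DDG) is a rooted binary tree (possibly infinite) whose leaves are each labeled by an outcome; sampling proceeds from the root by flipping a fair coin at each internal node (0 = left child, 1 = right child) until a leaf is reached, whose label is output. Any algorithm that reads fair coin flips one at a time and eventually outputs a value corresponds to such a DDG (the node reached after a sequence of flips records the flips so far; leaves are the flip sequences at which the algorithm outputs). For a DDG $T$ let $N(T)$ be the random number of flips used. A DDG $T$ with output distribution $p$ is optimal for $p$ if for every DDG $T'$ with output distribution $p$ and every $i \ge 0$, $\mathbb{P}(N(T) > i) \le \mathbb{P}(N(T') > i)$. -}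

module Defs where

open import Data.Nat using (ℕ; zero; suc; _+_; _*_; _∸_; _^_; _≤_; _<_; _≡ᵇ_; _≤ᵇ_; _<ᵇ_)
open import Data.Bool using (Bool; true; false; if_then_else_)
open import Data.List using (List; []; _∷_)
open import Data.Maybe using (Maybe; just; nothing)
open import Data.Product using (_×_; _,_; ∃-syntax)

-- A DDG with outcomes in A, presented as a coin-flipping algorithm:
-- T s = just a  means the node reached after the flip sequence s (in order)
-- is a leaf labelled a; T s = nothing means it is an internal node.
-- Only the first leaf along a path matters (nodes below a leaf are not part
-- of the tree), see `run`.
DDG : Set → Set
DDG A = List Bool → Maybe A

run : {A : Set} → DDG A → List Bool → Maybe A
run T [] = T []
run T (b ∷ bs) with T []
... | just a  = just a
... | nothing = run (λ s → T (b ∷ s)) bs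

bits : ℕ → List (List Bool)
bits zero = [] ∷ []
bits (suc i) = go (bits i)
  where
  go : List (List Bool) → List (List Bool)
  go [] = []
  go (s ∷ ss) = (false ∷ s) ∷ (true ∷ s) ∷ go ss

countIf : {A : Set} → (A → Bool) → List A → ℕ
countIf p [] = zero
countIf p (x ∷ xs) = if p x then suc (countIf p xs) else countIf p xs

isLabel : ℕ → Maybe ℕ → Bool
isLabel k (just x) = x ≡ᵇ k
isLabel k nothing  = false

isNothing : {A : Set} → Maybe A → Bool
isNothing (just _) = false
isNothing nothing  = true

-- number of length-i flip sequences on which T has output k:
-- P(T outputs k within i flips) = outCount T k i / 2^i
outCount : DDG ℕ → ℕ → ℕ → ℕ
outCount T k i = countIf (λ s → isLabel k (run T s)) (bits i)

-- number of length-i flip sequences on which T has not yet halted: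
-- P(N(T) > i) = pendingCount T i / 2^i
pendingCount : {A : Set} → DDG A → ℕ → ℕ
pendingCount T i = countIf (λ s → isNothing (run T s)) (bits i)

-- P(T outputs k) = a / b, where P(T outputs k) is the limit (supremum) of
-- the nondecreasing sequence outCount T k i / 2^i:
--   every term is ≤ a/b, and for every m some term exceeds a/b - 1/(m+1).
HasProb : DDG ℕ → ℕ → ℕ → ℕ → Set
HasProb T k a b =
  ((i : ℕ) → b * outCount T k i ≤ a * 2 ^ i) ×
  ((m : ℕ) → ∃[ i ] (suc m * (a * 2 ^ i ∸ b * outCount T k i) < b * 2 ^ i))

-- uniform distribution on {1,…,n}: numerator of P(k) over denominator n
uniformNum : ℕ → ℕ → ℕ
uniformNum n k = if (1 ≤ᵇ k) Data.Bool.∧ (k ≤ᵇ n) then 1 else 0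

HasUniformDist : ℕ → DDG ℕ → Set
HasUniformDist n T = (k : ℕ) → HasProb T k (uniformNum n k) n

step : ℕ → ℕ × ℕ → Bool → ℕ × ℕ
step n (m , X) b =
  let X' = X + (if b then m else 0)
      m' = 2 * m
  in if n ≤ᵇ m'
     then (if X' ≤ᵇ n then (n , X') else (m' ∸ n , X' ∸ n))
     else (m' , X')

exec : ℕ → ℕ × ℕ → List Bool → Maybe ℕ
exec n (m , X) bs with m <ᵇ n
... | false = just X
exec n (m , X) [] | true = nothing
exec n (m , X) (b ∷ bs) | true = exec n (step n (m , X) b) bs

optimalUniform : ℕ → DDG ℕ
optimalUniform n s = exec n (1 , 1) s

IsOptimalUniform : ℕ → DDG ℕ → Set
IsOptimalUniform n T =
  HasUniformDist n T ×
  ((T' : DDG ℕ) → HasUniformDist n T' → (i : ℕ) → pendingCount T i ≤ pendingCount T' i)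

{-# OPTIONS --safe #-}

-- For m ≤ n, call the loop states (m , 1), …, (m , m) the range m. A flip
-- turns range m into the doubled range 2m; when 2m ≥ n, steps 5–6 accept its
-- first n values and turn the other 2m − n into range 2m − n. By induction on
-- i, the runs from the states of range m together output each label
-- k ∈ {1,…,n} on ⌊m·2^i/n⌋ flip sequences of length i. The algorithm starts
-- in range 1, so it outputs k on ⌊2^i/n⌋ of the 2^i sequences, and this ratio
-- tends to 1/n since the remainder 2^i mod n stays below n. A DDG with the
-- uniform distribution never outputs a label outside {1,…,n} and outputs each
-- k on at most ⌊2^i/n⌋ sequences of length i, so at least 2^i − n⌊2^i/n⌋
-- sequences are still pending: exactly the number for the algorithm.

module Submission where

open import Defs
open import Data.Nat
  using (ℕ; zero; suc; _+_; _*_; _∸_; _^_; _≤_; _<_; _≡ᵇ_; _≤ᵇ_; _<ᵇ_; z≤n; z<s;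
         NonZero; >-nonZero; >-nonZero⁻¹; _≤?_; _<?_)
open import Data.Nat.Properties
open import Data.Nat.DivMod
open import Data.Nat.Divisibility using (m∣m*n)
open import Algebra.Properties.CommutativeSemigroup +-commutativeSemigroup
  using () renaming (interchange to +-interchange)
open import Data.Bool using (Bool; true; false; if_then_else_)
open import Data.List using (List; []; _∷_; length)
open import Data.List.Membership.Propositional using (_∈_)
open import Data.List.Relation.Unary.Any using (here; there)
open import Data.Maybe using (Maybe; just; nothing)
open import Data.Product using (_×_; _,_; proj₁; ∃-syntax)
open import Data.Sum using (_⊎_; inj₁; inj₂)
open import Function using (_∘_)
open import Relation.Nullary using (yes; no; contradiction)
open import Relation.Nullary.Decidable using (dec-true; dec-false)
open import Relation.Binary.PropositionalEquality
open ≡-Reasoning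

<ᵇ-true : ∀ {m n} → m < n → (m <ᵇ n) ≡ true
<ᵇ-true = dec-true (_ <? _)

<ᵇ-false : ∀ {m n} → n ≤ m → (m <ᵇ n) ≡ false
<ᵇ-false n≤m = dec-false (_ <? _) (≤⇒≯ n≤m)

≤ᵇ-true : ∀ {m n} → m ≤ n → (m ≤ᵇ n) ≡ true
≤ᵇ-true = dec-true (_ ≤? _)

≤ᵇ-false : ∀ {m n} → n < m → (m ≤ᵇ n) ≡ false
≤ᵇ-false n<m = dec-false (_ ≤? _) (<⇒≱ n<m)

≡ᵇ-refl : ∀ n → (n ≡ᵇ n) ≡ true
≡ᵇ-refl n = dec-true (n ≟ n) refl

≡ᵇ-sym : ∀ m n → (m ≡ᵇ n) ≡ (n ≡ᵇ m)
≡ᵇ-sym zero    zero    = refl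
≡ᵇ-sym zero    (suc n) = refl
≡ᵇ-sym (suc m) zero    = refl
≡ᵇ-sym (suc m) (suc n) = ≡ᵇ-sym m n

n<2^n : ∀ n → n < 2 ^ n
n<2^n zero    = z<s
n<2^n (suc n) = +-mono-≤ (m^n>0 2 n) (≤-trans (n<2^n n) (m≤m+n (2 ^ n) 0))

-- `bits (suc i)` is `bits i` expanded by the local function `go` of `bits`,
-- which cannot be named here; `interleave` is solved by unification to be it.
mutual
  interleave : ℕ → List (List Bool) → List (List Bool)
  interleave = _

  bits-suc : ∀ i → bits (suc i) ≡ interleave i (bits i)
  bits-suc i with bits i
  ... | _ = refl

length-interleave : ∀ i xs → length (interleave i xs) ≡ length xs + length xs
length-interleave i []       = refl
length-interleave i (s ∷ xs) =
  cong suc (trans (cong suc (length-interleave i xs)) (sym (+-suc (length xs) (length xs))))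

length-bits : ∀ i → length (bits i) ≡ 2 ^ i
length-bits zero    = refl
length-bits (suc i) = begin
  length (bits (suc i))              ≡⟨ cong length (bits-suc i) ⟩
  length (interleave i (bits i))     ≡⟨ length-interleave i (bits i) ⟩
  length (bits i) + length (bits i)  ≡⟨ cong (λ l → l + l) (length-bits i) ⟩
  2 ^ i + 2 ^ i                      ≡⟨ cong (2 ^ i +_) (+-identityʳ (2 ^ i)) ⟨
  2 ^ suc i                          ∎

countIf-interleave : ∀ i (p : List Bool → Bool) xs →
  countIf p (interleave i xs) ≡ countIf (p ∘ (false ∷_)) xs + countIf (p ∘ (true ∷_)) xs
countIf-interleave i p [] = refl
countIf-interleave i p (s ∷ xs) with p (false ∷ s) | p (true ∷ s) | countIf-interleave i p xs
... | true  | true  | ih = cong suc (trans (cong suc ih) (sym (+-suc _ _)))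
... | true  | false | ih = cong suc ih
... | false | true  | ih = trans (cong suc ih) (sym (+-suc _ _))
... | false | false | ih = ih

countIf-bits-suc : ∀ (p : List Bool → Bool) i →
  countIf p (bits (suc i)) ≡ countIf (p ∘ (false ∷_)) (bits i) + countIf (p ∘ (true ∷_)) (bits i)
countIf-bits-suc p i = trans (cong (countIf p) (bits-suc i)) (countIf-interleave i p (bits i))

countIf-cong : ∀ {A : Set} {p q : A → Bool} → (∀ x → p x ≡ q x) →
               ∀ xs → countIf p xs ≡ countIf q xs
countIf-cong p≗q [] = refl
countIf-cong {q = q} p≗q (x ∷ xs) rewrite p≗q x with q x
... | true  = cong suc (countIf-cong p≗q xs)
... | false = countIf-cong p≗q xs

countIf-const : ∀ {A : Set} b (xs : List A) → countIf (λ _ → b) xs ≡ (if b then length xs else 0)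
countIf-const true  []       = refl
countIf-const true  (x ∷ xs) = cong suc (countIf-const true xs)
countIf-const false []       = refl
countIf-const false (x ∷ xs) = countIf-const false xs

∈⇒countIf>0 : ∀ {A : Set} (p : A → Bool) {x xs} → x ∈ xs → p x ≡ true → 0 < countIf p xs
∈⇒countIf>0 p (here refl) px rewrite px = z<s
∈⇒countIf>0 p {xs = y ∷ _} (there x∈xs) px with p y
... | true  = m≤n⇒m≤1+n (∈⇒countIf>0 p x∈xs px)
... | false = ∈⇒countIf>0 p x∈xs px

sumTo : ℕ → (ℕ → ℕ) → ℕ
sumTo zero    f = 0
sumTo (suc m) f = sumTo m f + f (suc m)

sumTo-cong : ∀ m {f g : ℕ → ℕ} → (∀ {x} → 1 ≤ x → x ≤ m → f x ≡ g x) →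
             sumTo m f ≡ sumTo m g
sumTo-cong zero    f≗g = refl
sumTo-cong (suc m) f≗g =
  cong₂ _+_ (sumTo-cong m (λ 1≤x x≤m → f≗g 1≤x (m≤n⇒m≤1+n x≤m))) (f≗g z<s ≤-refl)

sumTo-mono-≤ : ∀ m {f g : ℕ → ℕ} → (∀ x → f x ≤ g x) → sumTo m f ≤ sumTo m g
sumTo-mono-≤ zero    f≤g = z≤n
sumTo-mono-≤ (suc m) f≤g = +-mono-≤ (sumTo-mono-≤ m f≤g) (f≤g (suc m))

sumTo-zero : ∀ m → sumTo m (λ _ → 0) ≡ 0
sumTo-zero zero    = refl
sumTo-zero (suc m) = trans (+-identityʳ _) (sumTo-zero m)

sumTo-+ : ∀ a b (f : ℕ → ℕ) → sumTo (a + b) f ≡ sumTo a f + sumTo b (λ y → f (a + y))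
sumTo-+ a zero    f = trans (cong (λ c → sumTo c f) (+-identityʳ a)) (sym (+-identityʳ _))
sumTo-+ a (suc b) f = begin
  sumTo (a + suc b) f
    ≡⟨ cong (λ c → sumTo c f) (+-suc a b) ⟩
  sumTo (a + b) f + f (suc (a + b))
    ≡⟨ cong (_+ f (suc (a + b))) (sumTo-+ a b f) ⟩
  sumTo a f + sumTo b (λ y → f (a + y)) + f (suc (a + b))
    ≡⟨ cong (λ c → sumTo a f + sumTo b (λ y → f (a + y)) + f c) (+-suc a b) ⟨
  sumTo a f + sumTo b (λ y → f (a + y)) + f (a + suc b)
    ≡⟨ +-assoc (sumTo a f) _ _ ⟩
  sumTo a f + sumTo (suc b) (λ y → f (a + y))
    ∎

sumTo-distrib-+ : ∀ m (f g : ℕ → ℕ) → sumTo m (λ x → f x + g x) ≡ sumTo m f + sumTo m g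
sumTo-distrib-+ zero    f g = refl
sumTo-distrib-+ (suc m) f g = begin
  sumTo m (λ x → f x + g x) + (f (suc m) + g (suc m))
    ≡⟨ cong (_+ (f (suc m) + g (suc m))) (sumTo-distrib-+ m f g) ⟩
  sumTo m f + sumTo m g + (f (suc m) + g (suc m))
    ≡⟨ +-interchange (sumTo m f) (sumTo m g) (f (suc m)) (g (suc m)) ⟩
  sumTo m f + f (suc m) + (sumTo m g + g (suc m))
    ∎

uniformNum-suc : ∀ n k → uniformNum (suc n) k ≡ uniformNum n k + (if suc n ≡ᵇ k then 1 else 0)
uniformNum-suc n zero    = refl
uniformNum-suc n (suc k) = <ᵇ-suc k n
  where
  <ᵇ-suc : ∀ k n →
    (if k <ᵇ suc n then 1 else 0) ≡ (if k <ᵇ n then 1 else 0) + (if n ≡ᵇ k then 1 else 0)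
  <ᵇ-suc zero    zero    = refl
  <ᵇ-suc zero    (suc n) = refl
  <ᵇ-suc (suc k) zero    = refl
  <ᵇ-suc (suc k) (suc n) = <ᵇ-suc k n

uniformNum≡0⊎1 : ∀ n k → uniformNum n k ≡ 0 ⊎ uniformNum n k ≡ 1
uniformNum≡0⊎1 n k = indicator≡0⊎1 _
  where
  indicator≡0⊎1 : ∀ b → (if b then 1 else 0) ≡ 0 ⊎ (if b then 1 else 0) ≡ 1
  indicator≡0⊎1 true  = inj₂ refl
  indicator≡0⊎1 false = inj₁ refl

uniformNum-*-/ : ∀ n k x d .{{_ : NonZero d}} → uniformNum n k * (x / d) ≡ uniformNum n k * x / d
uniformNum-*-/ n k x d with uniformNum≡0⊎1 n k
... | inj₁ u≡0 rewrite u≡0 = sym (0/n≡0 d)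
... | inj₂ u≡1 rewrite u≡1 = trans (*-identityˡ (x / d)) (cong (_/ d) (sym (*-identityˡ x)))

sumTo-indicator : ∀ n k c → sumTo n (λ j → if j ≡ᵇ k then c else 0) ≡ uniformNum n k * c
sumTo-indicator zero    zero    c = refl
sumTo-indicator zero    (suc k) c = refl
sumTo-indicator (suc n) k       c = begin
  sumTo n (λ j → if j ≡ᵇ k then c else 0) + (if suc n ≡ᵇ k then c else 0)
    ≡⟨ cong₂ _+_ (sumTo-indicator n k c) (if-then-c (suc n ≡ᵇ k)) ⟩
  uniformNum n k * c + (if suc n ≡ᵇ k then 1 else 0) * c
    ≡⟨ *-distribʳ-+ c (uniformNum n k) _ ⟨
  (uniformNum n k + (if suc n ≡ᵇ k then 1 else 0)) * c
    ≡⟨ cong (_* c) (uniformNum-suc n k) ⟨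
  uniformNum (suc n) k * c
    ∎
  where
  if-then-c : ∀ b → (if b then c else 0) ≡ (if b then 1 else 0) * c
  if-then-c true  = sym (*-identityˡ c)
  if-then-c false = refl

sumTo-increment : ∀ n j (c : ℕ → ℕ) → uniformNum n j ≡ 1 →
  sumTo n (λ k → if j ≡ᵇ k then suc (c k) else c k) ≡ suc (sumTo n c)
sumTo-increment n j c u≡1 = begin
  sumTo n (λ k → if j ≡ᵇ k then suc (c k) else c k)
    ≡⟨ sumTo-cong n (λ {k} _ _ → split k) ⟩
  sumTo n (λ k → (if k ≡ᵇ j then 1 else 0) + c k)
    ≡⟨ sumTo-distrib-+ n _ c ⟩
  sumTo n (λ k → if k ≡ᵇ j then 1 else 0) + sumTo n c
    ≡⟨ cong (_+ sumTo n c) (trans (sumTo-indicator n j 1) (cong (_* 1) u≡1)) ⟩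
  suc (sumTo n c)
    ∎
  where
  split : ∀ k → (if j ≡ᵇ k then suc (c k) else c k) ≡ (if k ≡ᵇ j then 1 else 0) + c k
  split k rewrite ≡ᵇ-sym j k with k ≡ᵇ j
  ... | true  = refl
  ... | false = refl

module _ {A : Set} where

  run-cong : {T T′ : DDG A} → (∀ s → T s ≡ T′ s) → ∀ s → run T s ≡ run T′ s
  run-cong T≗T′ [] = T≗T′ []
  run-cong {T} {T′} T≗T′ (b ∷ s) with T [] | T′ [] | T≗T′ []
  ... | just a  | .(just a) | refl = refl
  ... | nothing | .nothing  | refl = run-cong (λ s → T≗T′ (b ∷ s)) s

  run-leaf : {T : DDG A} {a : A} → T [] ≡ just a → ∀ s → run T s ≡ just a
  run-leaf T[]≡a []      = T[]≡a
  run-leaf T[]≡a (b ∷ s) rewrite T[]≡a = refl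

  run-internal : {T : DDG A} → T [] ≡ nothing → ∀ b s → run T (b ∷ s) ≡ run (λ s → T (b ∷ s)) s
  run-internal T[]≡nothing b s rewrite T[]≡nothing = refl

module _ {T : DDG ℕ} where

  outCount-cong : {T′ : DDG ℕ} → (∀ s → T s ≡ T′ s) → ∀ k i → outCount T k i ≡ outCount T′ k i
  outCount-cong T≗T′ k i = countIf-cong (λ s → cong (isLabel k) (run-cong T≗T′ s)) (bits i)

  outCount-leaf : ∀ {a} → T [] ≡ just a → ∀ k i → outCount T k i ≡ (if a ≡ᵇ k then 2 ^ i else 0)
  outCount-leaf {a} T[]≡a k i = begin
    outCount T k i
      ≡⟨ countIf-cong (λ s → cong (isLabel k) (run-leaf T[]≡a s)) (bits i) ⟩
    countIf (λ _ → a ≡ᵇ k) (bits i)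
      ≡⟨ countIf-const (a ≡ᵇ k) (bits i) ⟩
    (if a ≡ᵇ k then length (bits i) else 0)
      ≡⟨ cong (λ l → if a ≡ᵇ k then l else 0) (length-bits i) ⟩
    (if a ≡ᵇ k then 2 ^ i else 0)
      ∎

  outCount-internal-zero : T [] ≡ nothing → ∀ k → outCount T k 0 ≡ 0
  outCount-internal-zero T[]≡nothing k rewrite T[]≡nothing = refl

  outCount-internal-suc : T [] ≡ nothing → ∀ k i →
    outCount T k (suc i) ≡ outCount (λ s → T (false ∷ s)) k i + outCount (λ s → T (true ∷ s)) k i
  outCount-internal-suc T[]≡nothing k i =
    trans (countIf-bits-suc _ i) (cong₂ _+_ (subtree false) (subtree true))
    where
    subtree : ∀ b → countIf (λ s → isLabel k (run T (b ∷ s))) (bits i) ≡ outCount (λ s → T (b ∷ s)) k i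
    subtree b = countIf-cong (λ s → cong (isLabel k) (run-internal {T = T} T[]≡nothing b s)) (bits i)

-- Steps 5–6 of the loop: `step n (m , X) b` is, by definition,
-- `settle n (2 * m) (X + (if b then m else 0))`.
settle : ℕ → ℕ → ℕ → ℕ × ℕ
settle n d X = if n ≤ᵇ d then (if X ≤ᵇ n then (n , X) else (d ∸ n , X ∸ n)) else (d , X)

settle-< : ∀ {n d} X → d < n → settle n d X ≡ (d , X)
settle-< X d<n rewrite ≤ᵇ-false d<n = refl

settle-accept : ∀ {n d X} → n ≤ d → X ≤ n → settle n d X ≡ (n , X)
settle-accept n≤d X≤n rewrite ≤ᵇ-true n≤d | ≤ᵇ-true X≤n = refl

settle-reject : ∀ {n d X} → n ≤ d → n < X → settle n d X ≡ (d ∸ n , X ∸ n)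
settle-reject n≤d n<X rewrite ≤ᵇ-true n≤d | ≤ᵇ-false n<X = refl

module _ (n : ℕ) (F : ℕ × ℕ → ℕ) where

  sumTo-settle-< : ∀ {d} → d < n → sumTo d (F ∘ settle n d) ≡ sumTo d (λ X → F (d , X))
  sumTo-settle-< {d} d<n = sumTo-cong d (λ {X} _ _ → cong F (settle-< X d<n))

  sumTo-settle-≥ : ∀ {d} → n ≤ d →
    sumTo d (F ∘ settle n d) ≡ sumTo n (λ X → F (n , X)) + sumTo (d ∸ n) (λ X → F (d ∸ n , X))
  sumTo-settle-≥ {d} n≤d = begin
    sumTo d (F ∘ settle n d)
      ≡⟨ cong (λ e → sumTo e (F ∘ settle n d)) (m+[n∸m]≡n n≤d) ⟨
    sumTo (n + (d ∸ n)) (F ∘ settle n d)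
      ≡⟨ sumTo-+ n (d ∸ n) _ ⟩
    sumTo n (F ∘ settle n d) + sumTo (d ∸ n) (λ X → F (settle n d (n + X)))
      ≡⟨ cong₂ _+_ (sumTo-cong n (λ _ X≤n → cong F (settle-accept n≤d X≤n)))
                   (sumTo-cong (d ∸ n) (λ {X} 1≤X _ → cong F (rejected X 1≤X))) ⟩
    sumTo n (λ X → F (n , X)) + sumTo (d ∸ n) (λ X → F (d ∸ n , X))
      ∎
    where
    rejected : ∀ X → 1 ≤ X → settle n d (n + X) ≡ (d ∸ n , X)
    rejected X 1≤X = trans (settle-reject n≤d (m<m+n n 1≤X)) (cong (d ∸ n ,_) (m+n∸m≡n n X))

module _ {n m : ℕ} where

  exec-halted : ∀ X → n ≤ m → exec n (m , X) [] ≡ just X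
  exec-halted X n≤m rewrite <ᵇ-false n≤m = refl

  exec-pending : ∀ X → m < n → exec n (m , X) [] ≡ nothing
  exec-pending X m<n rewrite <ᵇ-true m<n = refl

  exec-step : ∀ X → m < n → ∀ b s → exec n (m , X) (b ∷ s) ≡ exec n (step n (m , X) b) s
  exec-step X m<n b s rewrite <ᵇ-true m<n = refl

module _ (n : ℕ) .{{_ : NonZero n}} (k : ℕ) where

  private
    u : ℕ
    u = uniformNum n k

  execCount : ℕ → ℕ × ℕ → ℕ
  execCount i st = outCount (exec n st) k i

  sumTo-execCount-suc : ∀ i {m} → m < n →
    sumTo m (λ X → execCount (suc i) (m , X)) ≡ sumTo (2 * m) (execCount i ∘ settle n (2 * m))
  sumTo-execCount-suc i {m} m<n = begin
    sumTo m (λ X → execCount (suc i) (m , X))  ≡⟨ sumTo-cong m (λ {X} _ _ → branches X) ⟩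
    sumTo m (λ X → g X + g (m + X))            ≡⟨ sumTo-distrib-+ m g (λ X → g (m + X)) ⟩
    sumTo m g + sumTo m (λ X → g (m + X))      ≡⟨ sumTo-+ m m g ⟨
    sumTo (m + m) g                            ≡⟨ cong (λ e → sumTo (m + e) g) (+-identityʳ m) ⟨
    sumTo (2 * m) g                            ∎
    where
    g : ℕ → ℕ
    g = execCount i ∘ settle n (2 * m)
    branches : ∀ X → execCount (suc i) (m , X) ≡ g X + g (m + X)
    branches X = begin
      execCount (suc i) (m , X)
        ≡⟨ outCount-internal-suc (exec-pending X m<n) k i ⟩
      outCount (λ s → exec n (m , X) (false ∷ s)) k i + outCount (λ s → exec n (m , X) (true ∷ s)) k i
        ≡⟨ cong₂ _+_ (outCount-cong (exec-step X m<n false) k i)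
                     (outCount-cong (exec-step X m<n true) k i) ⟩
      g (X + 0) + g (X + m)
        ≡⟨ cong₂ _+_ (cong g (+-identityʳ X)) (cong g (+-comm X m)) ⟩
      g X + g (m + X)
        ∎

  sumTo-execCount-halted : ∀ i → sumTo n (λ X → execCount i (n , X)) ≡ u * (n * 2 ^ i / n)
  sumTo-execCount-halted i = begin
    sumTo n (λ X → execCount i (n , X))
      ≡⟨ sumTo-cong n (λ {X} _ _ → outCount-leaf {T = exec n (n , X)} (exec-halted {n} X ≤-refl) k i) ⟩
    sumTo n (λ X → if X ≡ᵇ k then 2 ^ i else 0)
      ≡⟨ sumTo-indicator n k (2 ^ i) ⟩
    u * 2 ^ i
      ≡⟨ cong (u *_) (trans (cong (_/ n) (*-comm n (2 ^ i))) (m*n/n≡m (2 ^ i) n)) ⟨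
    u * (n * 2 ^ i / n)
      ∎

  mutual
    sumTo-execCount : ∀ i {m} → m ≤ n → sumTo m (λ X → execCount i (m , X)) ≡ u * (m * 2 ^ i / n)
    sumTo-execCount i m≤n with m≤n⇒m<n∨m≡n m≤n
    ... | inj₂ refl = sumTo-execCount-halted i
    ... | inj₁ m<n  = sumTo-execCount-pending i m<n

    sumTo-execCount-pending : ∀ i {m} → m < n →
      sumTo m (λ X → execCount i (m , X)) ≡ u * (m * 2 ^ i / n)
    sumTo-execCount-pending zero {m} m<n = begin
      sumTo m (λ X → execCount 0 (m , X))
        ≡⟨ sumTo-cong m (λ {X} _ _ → outCount-internal-zero {T = exec n (m , X)} (exec-pending X m<n) k) ⟩
      sumTo m (λ _ → 0)
        ≡⟨ sumTo-zero m ⟩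
      0
        ≡⟨ *-zeroʳ u ⟨
      u * 0
        ≡⟨ cong (u *_) (m<n⇒m/n≡0 (subst (_< n) (sym (*-identityʳ m)) m<n)) ⟨
      u * (m * 2 ^ 0 / n)
        ∎
    sumTo-execCount-pending (suc i) {m} m<n = begin
      sumTo m (λ X → execCount (suc i) (m , X))       ≡⟨ sumTo-execCount-suc i m<n ⟩
      sumTo (2 * m) (execCount i ∘ settle n (2 * m))  ≡⟨ sumTo-execCount-settle i 2m≤n+n ⟩
      u * (2 * m * 2 ^ i / n)                         ≡⟨ cong (λ e → u * (e / n)) 2m*2^i≡m*2^[1+i] ⟩
      u * (m * 2 ^ suc i / n)                         ∎
      where
      2m≤n+n : 2 * m ≤ n + n
      2m≤n+n = +-mono-≤ (<⇒≤ m<n) (subst (_≤ n) (sym (+-identityʳ m)) (<⇒≤ m<n))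
      2m*2^i≡m*2^[1+i] : 2 * m * 2 ^ i ≡ m * 2 ^ suc i
      2m*2^i≡m*2^[1+i] = trans (cong (_* 2 ^ i) (*-comm 2 m)) (*-assoc m 2 (2 ^ i))

    sumTo-execCount-settle : ∀ i {d} → d ≤ n + n →
      sumTo d (execCount i ∘ settle n d) ≡ u * (d * 2 ^ i / n)
    sumTo-execCount-settle i {d} d≤n+n with d <? n
    ... | yes d<n = trans (sumTo-settle-< n (execCount i) d<n) (sumTo-execCount i (<⇒≤ d<n))
    ... | no d≮n = begin
      sumTo d (execCount i ∘ settle n d)
        ≡⟨ sumTo-settle-≥ n (execCount i) n≤d ⟩
      sumTo n (λ X → execCount i (n , X)) + sumTo (d ∸ n) (λ X → execCount i (d ∸ n , X))
        ≡⟨ cong₂ _+_ (sumTo-execCount i ≤-refl) (sumTo-execCount i (m≤n+o⇒m∸n≤o d n d≤n+n)) ⟩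
      u * (n * 2 ^ i / n) + u * ((d ∸ n) * 2 ^ i / n)
        ≡⟨ *-distribˡ-+ u _ _ ⟨
      u * (n * 2 ^ i / n + (d ∸ n) * 2 ^ i / n)
        ≡⟨ cong (u *_) (+-distrib-/-∣ˡ _ (m∣m*n (2 ^ i))) ⟨
      u * ((n * 2 ^ i + (d ∸ n) * 2 ^ i) / n)
        ≡⟨ cong (λ e → u * (e / n)) (*-distribʳ-+ (2 ^ i) n (d ∸ n)) ⟨
      u * ((n + (d ∸ n)) * 2 ^ i / n)
        ≡⟨ cong (λ e → u * (e * 2 ^ i / n)) (m+[n∸m]≡n n≤d) ⟩
      u * (d * 2 ^ i / n)
        ∎
      where
      n≤d : n ≤ d
      n≤d = ≮⇒≥ d≮n

outCount-optimalUniform : ∀ n .{{_ : NonZero n}} k i →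
  outCount (optimalUniform n) k i ≡ uniformNum n k * 2 ^ i / n
outCount-optimalUniform n k i = begin
  outCount (optimalUniform n) k i   ≡⟨ sumTo-execCount n k i (>-nonZero⁻¹ n) ⟩
  uniformNum n k * (1 * 2 ^ i / n)  ≡⟨ cong (λ e → uniformNum n k * (e / n)) (*-identityˡ (2 ^ i)) ⟩
  uniformNum n k * (2 ^ i / n)      ≡⟨ uniformNum-*-/ n k (2 ^ i) n ⟩
  uniformNum n k * 2 ^ i / n        ∎

module _ {T : DDG ℕ} {k a b : ℕ} .{{_ : NonZero b}} where

  hasProb-floor : (∀ i → outCount T k i ≡ a * 2 ^ i / b) → HasProb T k a b
  hasProb-floor count = below , close
    where
    below : ∀ i → b * outCount T k i ≤ a * 2 ^ i
    below i rewrite count i = subst (_≤ a * 2 ^ i) (*-comm _ b) (m/n*n≤m (a * 2 ^ i) b)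
    close : ∀ M → ∃[ i ] (suc M * (a * 2 ^ i ∸ b * outCount T k i) < b * 2 ^ i)
    close M = M , <-≤-trans (*-monoʳ-< (suc M) gap<b)
                            (subst (suc M * b ≤_) (*-comm (2 ^ M) b) (*-monoˡ-≤ b (n<2^n M)))
      where
      gap<b : a * 2 ^ M ∸ b * outCount T k M < b
      gap<b rewrite count M | *-comm b (a * 2 ^ M / b) | sym (m%n≡m∸m/n*n (a * 2 ^ M) b) =
        m%n<n (a * 2 ^ M) b

  hasProb⇒outCount≤ : HasProb T k a b → ∀ i → outCount T k i ≤ a * 2 ^ i / b
  hasProb⇒outCount≤ (below , _) i = subst (_≤ a * 2 ^ i / b) (m*n/n≡m (outCount T k i) b)
    (/-monoˡ-≤ b (subst (_≤ a * 2 ^ i) (*-comm b _) (below i)))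

hasUniformDist-optimalUniform : ∀ n .{{_ : NonZero n}} → HasUniformDist n (optimalUniform n)
hasUniformDist-optimalUniform n k = hasProb-floor {a = uniformNum n k} (outCount-optimalUniform n k)

length≡pending+sumTo-outputs : ∀ n (f : List Bool → Maybe ℕ) xs →
  (∀ {s j} → s ∈ xs → f s ≡ just j → uniformNum n j ≡ 1) →
  length xs ≡ countIf (isNothing ∘ f) xs + sumTo n (λ k → countIf (isLabel k ∘ f) xs)
length≡pending+sumTo-outputs n f [] _ = sym (sumTo-zero n)
length≡pending+sumTo-outputs n f (x ∷ xs) supported with f x in fx
... | nothing = cong suc (length≡pending+sumTo-outputs n f xs (supported ∘ there))
... | just j  = begin
  suc (length xs)
    ≡⟨ cong suc (length≡pending+sumTo-outputs n f xs (supported ∘ there)) ⟩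
  suc (P + S)
    ≡⟨ +-suc P S ⟨
  P + suc S
    ≡⟨ cong (P +_) (sumTo-increment n j _ (supported (here refl) fx)) ⟨
  P + sumTo n (λ k → if j ≡ᵇ k then suc (countIf (isLabel k ∘ f) xs) else countIf (isLabel k ∘ f) xs)
    ∎
  where
  P S : ℕ
  P = countIf (isNothing ∘ f) xs
  S = sumTo n (λ k → countIf (isLabel k ∘ f) xs)

module _ {n : ℕ} .{{_ : NonZero n}} {T : DDG ℕ} (uniform : HasUniformDist n T) where

  output⇒uniformNum≡1 : ∀ {i s j} → s ∈ bits i → run T s ≡ just j → uniformNum n j ≡ 1
  output⇒uniformNum≡1 {i} {s} {j} s∈bits run≡j with uniformNum≡0⊎1 n j
  ... | inj₂ u≡1 = u≡1
  ... | inj₁ u≡0 =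
    contradiction (subst (λ u → 0 < u * 2 ^ i) u≡0 (≤-trans hit (proj₁ (uniform j) i))) λ ()
    where
    hit : 0 < n * outCount T j i
    hit = *-mono-≤ (>-nonZero⁻¹ n) (∈⇒countIf>0 _ s∈bits (trans (cong (isLabel j) run≡j) (≡ᵇ-refl j)))

  pendingCount+sumTo-outCount : ∀ i → pendingCount T i + sumTo n (λ k → outCount T k i) ≡ 2 ^ i
  pendingCount+sumTo-outCount i = trans
    (sym (length≡pending+sumTo-outputs n (run T) (bits i) (output⇒uniformNum≡1 {i})))
    (length-bits i)

  outCount≤outCount-optimalUniform : ∀ k i → outCount T k i ≤ outCount (optimalUniform n) k i
  outCount≤outCount-optimalUniform k i = subst (outCount T k i ≤_) (sym (outCount-optimalUniform n k i))
    (hasProb⇒outCount≤ {a = uniformNum n k} (uniform k) i)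

pendingCount-optimalUniform-≤ : ∀ n .{{_ : NonZero n}} (T : DDG ℕ) → HasUniformDist n T →
  ∀ i → pendingCount (optimalUniform n) i ≤ pendingCount T i
pendingCount-optimalUniform-≤ n T uniform i =
  +-cancelʳ-≤ S P* P (subst (_≤ P + S) total≡ (+-monoʳ-≤ P outputs≤))
  where
  P P* S : ℕ
  P  = pendingCount T i
  P* = pendingCount (optimalUniform n) i
  S  = sumTo n (λ k → outCount (optimalUniform n) k i)
  outputs≤ : sumTo n (λ k → outCount T k i) ≤ S
  outputs≤ = sumTo-mono-≤ n (λ k → outCount≤outCount-optimalUniform uniform k i)
  total≡ : P + sumTo n (λ k → outCount T k i) ≡ P* + S
  total≡ = trans (pendingCount+sumTo-outCount uniform i)
                 (sym (pendingCount+sumTo-outCount (hasUniformDist-optimalUniform n) i))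

theorem3 : (n : ℕ) → 1 ≤ n → IsOptimalUniform n (optimalUniform n)
theorem3 n 1≤n = hasUniformDist-optimalUniform n , pendingCount-optimalUniform-≤ n
  where
  instance
    n≢0 : NonZero n
    n≢0 = >-nonZero 1≤n
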